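{- Let $G$ be a finite, simple, connected graph which is randomly $k$-dimensional with $k\geq 4$. Then $G$ contains no two adjacent vertices that both have degree $2$.
   Context: $d(x,y)$ is the distance in $G$. For an ordered set $W=\{w_1,\ldots,w_k\}\subseteq V(G)$ and $v\in V(G)$, $r(v|W)=(d(v,w_1),\ldots,d(v,w_k))$. $W$ is a resolving set if distinct vertices have distinct representations with respect to $W$. The metric dimension $\beta(G)$ is the minimum size of a resolving set; a resolving set of size $\beta(G)$ is a basis. $G$ is randomly $k$-dimensional if $\beta(G)=k$ and every $k$-subset of $V(G)$ is a basis of $G$. -}

module Defs where

open import Data.Nat using (ℕ; zero; suc; _≤_; _<_)
open import Data.Bool using (Bool; T)
open import Data.Fin using (Fin)
open import Data.Fin.Subset using (Subset; _∈_; ∣_∣)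
open import Data.List using (length; filter; allFin)
open import Data.Product using (_×_; ∃-syntax)
open import Relation.Nullary using (¬_)
open import Relation.Nullary.Decidable using (T?)
open import Relation.Binary.PropositionalEquality using (_≡_)

record Graph : Set where
  field
    n      : ℕ
    adj    : Fin n → Fin n → Bool
    sym    : ∀ x y → T (adj x y) → T (adj y x)
    irrefl : ∀ x → ¬ T (adj x x)

open Graph public

Vertex : Graph → Set
Vertex G = Fin (n G)

Adjacent : (G : Graph) → Vertex G → Vertex G → Set
Adjacent G x y = T (adj G x y)

data Walk (G : Graph) : Vertex G → Vertex G → ℕ → Set where
  here : ∀ {x} → Walk G x x zero
  step : ∀ {x y z m} → Adjacent G x y → Walk G y z m → Walk G x z (suc m)

Connected : Graph → Set
Connected G = ∀ (x y : Vertex G) → ∃[ m ] Walk G x y m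

Dist : (G : Graph) → Vertex G → Vertex G → ℕ → Set
Dist G x y m = Walk G x y m × (∀ m' → Walk G x y m' → m ≤ m')

degree : (G : Graph) → Vertex G → ℕ
degree G v = length (filter (λ u → T? (adj G v u)) (allFin (n G)))

Resolving : (G : Graph) → Subset (n G) → Set
Resolving G W = ∀ (u v : Vertex G) →
  (∀ w → w ∈ W → ∀ a b → Dist G u w a → Dist G v w b → a ≡ b) → u ≡ v

MetricDimension : Graph → ℕ → Set
MetricDimension G k =
  (∃[ W ] (∣ W ∣ ≡ k × Resolving G W)) ×
  (∀ W → ∣ W ∣ < k → ¬ Resolving G W)

RandomlyDimensional : Graph → ℕ → Set
RandomlyDimensional G k =
  MetricDimension G k × (∀ W → ∣ W ∣ ≡ k → Resolving G W)

-- Let u ~ v have degree 2, with further neighbours a of u and b of v. A vertex y ≠ u reaches u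
-- only through v or a, so d(y,u) = 1 + min(d(y,v), d(y,a)); and u is the only vertex at distance 1
-- from v whose distance to b is d(u,b). Hence for any W ⊇ {u,v,a,b}, the set W - u resolves G
-- whenever W does. Taking W of size k (possible since k ≥ 4), W is a basis by randomness, so
-- W - u is a resolving set of size k - 1 < β(G), a contradiction.
module Submission where

open import Defs hiding (sym)
open import Data.Nat using (ℕ; zero; suc; _≤_; _<_; _+_; _⊓_; z≤n; s≤s; s≤s⁻¹; _≤?_)
open import Data.Nat.Properties
  using (≤-refl; ≤-trans; ≤-reflexive; ≤-antisym; ≮⇒≥; ≤∧≮⇒≡; m<1+n⇒m<n∨m≡n; n≤1+n;
         +-monoʳ-≤; +-suc; m⊓n≤m; m⊓n≤n; ⊓-sel)
open import Data.Fin using (Fin)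
open import Data.Fin.Properties using (any?; _≟_)
open import Data.Fin.Subset using (Subset; inside; outside; _∈_; ∣_∣; _⊆_; _-_; ⁅_⁆; _∪_)
open import Data.Fin.Subset.Properties
  using (∣p∣≤n; s⊆s; out⊆; x∈⁅x⁆; ∣⁅x⁆∣≡1; x∈p∪q⁺; x∈p∧x≢y⇒x∈p-y; x∈p⇒∣p-x∣<∣p∣)
open import Data.Vec using ([]; _∷_)
open import Data.List using (List; []; _∷_; length; filter; allFin)
import Data.List.Membership.Propositional as List
open import Data.List.Membership.Propositional.Properties using (∈-filter⁺; ∈-filter⁻; ∈-allFin)
open import Data.List.Relation.Unary.Any using (here; there)
open import Data.List.Relation.Unary.All using ([]; _∷_)
open import Data.List.Relation.Unary.AllPairs using (_∷_)
open import Data.List.Relation.Unary.Unique.Propositional using (Unique)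
open import Data.List.Relation.Unary.Unique.Propositional.Properties using (filter⁺; allFin⁺)
open import Data.Product using (_×_; _,_; proj₁; proj₂; ∃-syntax)
open import Data.Sum using (_⊎_; inj₁; inj₂)
open import Function using (id; _∘_)
open import Relation.Nullary using (¬_; Dec; yes; no; contradiction)
open import Relation.Nullary.Decidable using (T?; _×-dec_)
open import Relation.Unary using (Decidable)
open import Relation.Binary.PropositionalEquality using (_≡_; _≢_; refl; sym; trans; cong; subst)

module _ {P : ℕ → Set} (P? : Decidable P) where

  private
    search : ∀ M → (∀ m → m < M → ¬ P m) ⊎ ∃[ m ] (P m × (∀ m' → P m' → m ≤ m'))
    search zero = inj₁ (λ _ ())
    search (suc M) with search M
    ... | inj₂ least = inj₂ least
    ... | inj₁ none with P? M
    ...   | yes pM = inj₂ (M , pM , λ m' pm' → ≮⇒≥ (λ m'<M → none m' m'<M pm'))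
    ...   | no ¬pM = inj₁ λ m m<1+M → case (m<1+n⇒m<n∨m≡n m<1+M)
      where
      case : ∀ {m} → m < M ⊎ m ≡ M → ¬ P m
      case (inj₁ m<M) = none _ m<M
      case (inj₂ refl) = ¬pM

  least-witness : ∀ {M} → P M → ∃[ m ] (P m × (∀ m' → P m' → m ≤ m'))
  least-witness {M} pM with search (suc M)
  ... | inj₁ none = contradiction pM (none M ≤-refl)
  ... | inj₂ least = least

partner-in-pair : ∀ {A : Set} {xs : List A} {x} → Unique xs → length xs ≡ 2 → x List.∈ xs →
  ∃[ y ] (y List.∈ xs × y ≢ x × (∀ {z} → z List.∈ xs → z ≡ x ⊎ z ≡ y))
partner-in-pair {xs = []} _ () _
partner-in-pair {xs = _ ∷ []} _ () _
partner-in-pair {xs = _ ∷ _ ∷ _ ∷ _} _ () _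
partner-in-pair {xs = p ∷ q ∷ []} ((p≢q ∷ []) ∷ _) refl (here refl) =
  q , there (here refl) , p≢q ∘ sym ,
  λ { (here refl) → inj₁ refl ; (there (here refl)) → inj₂ refl ; (there (there ())) }
partner-in-pair {xs = p ∷ q ∷ []} ((p≢q ∷ []) ∷ _) refl (there (here refl)) =
  p , here refl , p≢q ,
  λ { (here refl) → inj₂ refl ; (there (here refl)) → inj₁ refl ; (there (there ())) }

∣p∪q∣≤∣p∣+∣q∣ : ∀ {m} (p q : Subset m) → ∣ p ∪ q ∣ ≤ ∣ p ∣ + ∣ q ∣
∣p∪q∣≤∣p∣+∣q∣ [] [] = z≤n
∣p∪q∣≤∣p∣+∣q∣ (inside ∷ p) (inside ∷ q) =
  s≤s (≤-trans (∣p∪q∣≤∣p∣+∣q∣ p q) (+-monoʳ-≤ ∣ p ∣ (n≤1+n ∣ q ∣)))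
∣p∪q∣≤∣p∣+∣q∣ (inside ∷ p) (outside ∷ q) = s≤s (∣p∪q∣≤∣p∣+∣q∣ p q)
∣p∪q∣≤∣p∣+∣q∣ (outside ∷ p) (inside ∷ q) =
  ≤-trans (s≤s (∣p∪q∣≤∣p∣+∣q∣ p q)) (≤-reflexive (sym (+-suc ∣ p ∣ ∣ q ∣)))
∣p∪q∣≤∣p∣+∣q∣ (outside ∷ p) (outside ∷ q) = ∣p∪q∣≤∣p∣+∣q∣ p q

∣⁅x⁆∪p∣≤1+∣p∣ : ∀ {m} (x : Fin m) p → ∣ ⁅ x ⁆ ∪ p ∣ ≤ suc ∣ p ∣
∣⁅x⁆∪p∣≤1+∣p∣ x p = subst (λ c → ∣ ⁅ x ⁆ ∪ p ∣ ≤ c + ∣ p ∣) (∣⁅x⁆∣≡1 x) (∣p∪q∣≤∣p∣+∣q∣ ⁅ x ⁆ p)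

superset-of-size : ∀ {m} (p : Subset m) {k} → ∣ p ∣ ≤ k → k ≤ m → ∃[ q ] (p ⊆ q × ∣ q ∣ ≡ k)
superset-of-size [] {zero} _ _ = [] , id , refl
superset-of-size (inside ∷ p) {suc k} (s≤s ∣p∣≤k) (s≤s k≤m)
  with q , p⊆q , ∣q∣≡k ← superset-of-size p ∣p∣≤k k≤m = inside ∷ q , s⊆s p⊆q , cong suc ∣q∣≡k
superset-of-size {suc m} (outside ∷ p) {k} ∣p∣≤k k≤1+m with k ≤? m
... | yes k≤m
  with q , p⊆q , ∣q∣≡k ← superset-of-size p ∣p∣≤k k≤m = outside ∷ q , s⊆s p⊆q , ∣q∣≡k
... | no k≰m
  with refl ← ≤∧≮⇒≡ k≤1+m (k≰m ∘ s≤s⁻¹)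
  with q , p⊆q , ∣q∣≡m ← superset-of-size p (∣p∣≤n p) ≤-refl = inside ∷ q , out⊆ p⊆q , cong suc ∣q∣≡m

∣⁅x⁆∪⁅y⁆∪⁅z⁆∪⁅w⁆∣≤4 : ∀ {m} (x y z w : Fin m) → ∣ ⁅ x ⁆ ∪ ⁅ y ⁆ ∪ ⁅ z ⁆ ∪ ⁅ w ⁆ ∣ ≤ 4
∣⁅x⁆∪⁅y⁆∪⁅z⁆∪⁅w⁆∣≤4 x y z w =
  ≤-trans (∣⁅x⁆∪p∣≤1+∣p∣ x _) (s≤s (≤-trans (∣⁅x⁆∪p∣≤1+∣p∣ y _) (s≤s
    (≤-trans (∣⁅x⁆∪p∣≤1+∣p∣ z _) (s≤s (≤-reflexive (∣⁅x⁆∣≡1 w)))))))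

subset-of-size-containing : ∀ {m k} (x y z w : Fin m) → 4 ≤ k → k ≤ m →
  ∃[ W ] (x ∈ W × y ∈ W × z ∈ W × w ∈ W × ∣ W ∣ ≡ k)
subset-of-size-containing x y z w 4≤k k≤m
  with W , T⊆W , ∣W∣≡k ← superset-of-size (⁅ x ⁆ ∪ ⁅ y ⁆ ∪ ⁅ z ⁆ ∪ ⁅ w ⁆)
                           (≤-trans (∣⁅x⁆∪⁅y⁆∪⁅z⁆∪⁅w⁆∣≤4 x y z w) 4≤k) k≤m
  = W , T⊆W (x∈p∪q⁺ (inj₁ (x∈⁅x⁆ x)))
      , T⊆W (x∈p∪q⁺ (inj₂ (x∈p∪q⁺ (inj₁ (x∈⁅x⁆ y)))))
      , T⊆W (x∈p∪q⁺ (inj₂ (x∈p∪q⁺ (inj₂ (x∈p∪q⁺ (inj₁ (x∈⁅x⁆ z)))))))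
      , T⊆W (x∈p∪q⁺ (inj₂ (x∈p∪q⁺ (inj₂ (x∈p∪q⁺ (inj₂ (x∈⁅x⁆ w)))))))
      , ∣W∣≡k

module _ (G : Graph) where

  adjacent-sym : ∀ {x y} → Adjacent G x y → Adjacent G y x
  adjacent-sym {x} {y} = Graph.sym G x y

  walk-length-zero : ∀ {x y} → Walk G x y 0 → x ≡ y
  walk-length-zero here = refl

  snoc : ∀ {x y z m} → Walk G x y m → Adjacent G y z → Walk G x z (suc m)
  snoc here y~z = step y~z here
  snoc (step x~w w) y~z = step x~w (snoc w y~z)

  reverse : ∀ {x y m} → Walk G x y m → Walk G y x m
  reverse here = here
  reverse (step {x} {w} x~w w⋯y) = snoc (reverse w⋯y) (adjacent-sym x~w)

  walk? : ∀ x y m → Dec (Walk G x y m)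
  walk? x y zero with x ≟ y
  ... | yes refl = yes here
  ... | no x≢y = no (x≢y ∘ walk-length-zero)
  walk? x y (suc m) with any? (λ w → T? (adj G x w) ×-dec walk? w y m)
  ... | yes (w , x~w , w⋯y) = yes (step x~w w⋯y)
  ... | no ¬step = no λ { (step x~w w⋯y) → ¬step (_ , x~w , w⋯y) }

  dist-exists : Connected G → ∀ x y → ∃[ m ] Dist G x y m
  dist-exists connected x y = least-witness (walk? x y) (proj₂ (connected x y))

  dist-unique : ∀ {x y m m'} → Dist G x y m → Dist G x y m' → m ≡ m'
  dist-unique (w , minimal) (w' , minimal') = ≤-antisym (minimal _ w') (minimal' _ w)

  dist-refl : ∀ {x} → Dist G x x 0
  dist-refl = here , λ _ _ → z≤n

  adjacent-irrefl : ∀ {x y} → Adjacent G x y → y ≢ x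
  adjacent-irrefl {x} x~x refl = irrefl G x x~x

  adjacent⇒dist-one : ∀ {x y} → Adjacent G x y → Dist G x y 1
  adjacent⇒dist-one x~y = step x~y here , λ
    { zero w → contradiction (sym (walk-length-zero w)) (adjacent-irrefl x~y)
    ; (suc m) _ → s≤s z≤n }

  dist-one⇒adjacent : ∀ {x y} → Dist G x y 1 → Adjacent G x y
  dist-one⇒adjacent (step x~y here , _) = x~y

  NeighboursAmong : Vertex G → Vertex G → Vertex G → Set
  NeighboursAmong u v a = ∀ {r} → Adjacent G u r → r ≡ v ⊎ r ≡ a

  neighbours : Vertex G → List (Vertex G)
  neighbours v = filter (λ u → T? (adj G v u)) (allFin (n G))

  adjacent⇒∈-neighbours : ∀ {v r} → Adjacent G v r → r List.∈ neighbours v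
  adjacent⇒∈-neighbours {v} {r} = ∈-filter⁺ (λ u → T? (adj G v u)) (∈-allFin r)

  ∈-neighbours⇒adjacent : ∀ {v r} → r List.∈ neighbours v → Adjacent G v r
  ∈-neighbours⇒adjacent {v} = proj₂ ∘ ∈-filter⁻ (λ u → T? (adj G v u)) {xs = allFin (n G)}

  neighbours-unique : ∀ v → Unique (neighbours v)
  neighbours-unique v = filter⁺ (λ u → T? (adj G v u)) (allFin⁺ (n G))

  degree-two-partner : ∀ {v p} → degree G v ≡ 2 → Adjacent G v p →
    ∃[ q ] (Adjacent G v q × q ≢ p × NeighboursAmong v p q)
  degree-two-partner {v} deg v~p
    with q , q∈N , q≢p , onlyPQ ← partner-in-pair (neighbours-unique v) deg (adjacent⇒∈-neighbours v~p)
    = q , ∈-neighbours⇒adjacent q∈N , q≢p , onlyPQ ∘ adjacent⇒∈-neighbours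

  dist-through-two-neighbours : ∀ {u v a y p q} → Adjacent G u v → Adjacent G u a →
    NeighboursAmong u v a → y ≢ u →
    Dist G y v p → Dist G y a q → Dist G y u (suc (p ⊓ q))
  dist-through-two-neighbours {u} {v} {a} {y} {p} {q} u~v u~a onlyVA y≢u (y⋯v , min-v) (y⋯a , min-a) =
    shortest (⊓-sel p q) , lower
    where
    shortest : p ⊓ q ≡ p ⊎ p ⊓ q ≡ q → Walk G y u (suc (p ⊓ q))
    shortest (inj₁ eq) rewrite eq = snoc y⋯v (adjacent-sym u~v)
    shortest (inj₂ eq) rewrite eq = snoc y⋯a (adjacent-sym u~a)
    lower : ∀ m → Walk G y u m → suc (p ⊓ q) ≤ m
    lower m y⋯u with reverse y⋯u
    ... | here = contradiction refl y≢u
    ... | step {y = r} u~r r⋯y with onlyVA u~r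
    ...   | inj₁ refl = s≤s (≤-trans (m⊓n≤m p q) (min-v _ (reverse r⋯y)))
    ...   | inj₂ refl = s≤s (≤-trans (m⊓n≤n p q) (min-a _ (reverse r⋯y)))

  SameDistanceTo : Vertex G → Vertex G → Vertex G → Set
  SameDistanceTo w y z = ∀ A B → Dist G y w A → Dist G z w B → A ≡ B

  same-distance-sym : ∀ {w y z} → SameDistanceTo w y z → SameDistanceTo w z y
  same-distance-sym same A B dA dB = sym (same B A dB dA)

  same-distance-through-two-neighbours : Connected G → ∀ {u v a y z} →
    Adjacent G u v → Adjacent G u a → NeighboursAmong u v a →
    y ≢ u → z ≢ u → SameDistanceTo v y z → SameDistanceTo a y z → SameDistanceTo u y z
  same-distance-through-two-neighbours connected {u} {v} {a} {y} {z} u~v u~a onlyVA y≢u z≢u sameV sameA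
    A B dA dB
    with p , dyv ← dist-exists connected y v | p' , dzv ← dist-exists connected z v
       | q , dya ← dist-exists connected y a | q' , dza ← dist-exists connected z a
    with refl ← sameV p p' dyv dzv | refl ← sameA q q' dya dza
    = trans (dist-unique dA (dist-through-two-neighbours u~v u~a onlyVA y≢u dyv dya))
            (dist-unique (dist-through-two-neighbours u~v u~a onlyVA z≢u dzv dza) dB)

  same-distance-to-neighbour-and-partner : Connected G → ∀ {u v b z} →
    Adjacent G v u → NeighboursAmong v u b → b ≢ u →
    SameDistanceTo v u z → SameDistanceTo b u z → z ≡ u
  same-distance-to-neighbour-and-partner connected {u} {v} {b} {z} v~u onlyUB b≢u sameV sameB
    with m , dzv ← dist-exists connected z v
    with refl ← sameV 1 m (adjacent⇒dist-one (adjacent-sym v~u)) dzv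
    with onlyUB (adjacent-sym (dist-one⇒adjacent dzv))
  ... | inj₁ z≡u = z≡u
  ... | inj₂ refl
    with A , dub ← dist-exists connected u b
    with refl ← sameB A 0 dub dist-refl
    = contradiction (sym (walk-length-zero (proj₁ dub))) b≢u

  resolving-minus-degree-two : Connected G → ∀ {W u v a b} →
    Adjacent G u v → Adjacent G u a → NeighboursAmong u v a →
    NeighboursAmong v u b → b ≢ u →
    v ∈ W → a ∈ W → b ∈ W → Resolving G W → Resolving G (W - u)
  resolving-minus-degree-two connected {W} {u} {v} {a} {b} u~v u~a onlyVA onlyUB b≢u v∈W a∈W b∈W
    resolving y z same
    with y ≟ u
  ... | yes refl = sym (same-distance-to-neighbour-and-partner connected (adjacent-sym u~v) onlyUB b≢u
                         (same v (x∈p∧x≢y⇒x∈p-y v∈W (adjacent-irrefl u~v)))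
                         (same b (x∈p∧x≢y⇒x∈p-y b∈W b≢u)))
  ... | no y≢u with z ≟ u
  ...   | yes refl = same-distance-to-neighbour-and-partner connected (adjacent-sym u~v) onlyUB b≢u
                       (same-distance-sym (same v (x∈p∧x≢y⇒x∈p-y v∈W (adjacent-irrefl u~v))))
                       (same-distance-sym (same b (x∈p∧x≢y⇒x∈p-y b∈W b≢u)))
  ...   | no z≢u = resolving y z sameOnW
    where
    sameOnW : ∀ w → w ∈ W → SameDistanceTo w y z
    sameOnW w w∈W with w ≟ u
    ... | no w≢u = same w (x∈p∧x≢y⇒x∈p-y w∈W w≢u)
    ... | yes refl = same-distance-through-two-neighbours connected u~v u~a onlyVA y≢u z≢u
                       (same v (x∈p∧x≢y⇒x∈p-y v∈W (adjacent-irrefl u~v)))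
                       (same a (x∈p∧x≢y⇒x∈p-y a∈W (adjacent-irrefl u~a)))

mainTheorem5 : (G : Graph) (k : ℕ) → Connected G → 4 ≤ k → RandomlyDimensional G k →
    ¬ (∃[ u ] ∃[ v ] (Adjacent G u v × degree G u ≡ 2 × degree G v ≡ 2))
mainTheorem5 G k connected 4≤k (((W₀ , ∣W₀∣≡k , _) , noSmallerResolving) , everyResolving)
  (u , v , u~v , deg-u , deg-v)
  with a , u~a , _ , onlyVA ← degree-two-partner G deg-u u~v
     | b , _ , b≢u , onlyUB ← degree-two-partner G deg-v (adjacent-sym G u~v)
  with W , u∈W , v∈W , a∈W , b∈W , ∣W∣≡k
         ← subset-of-size-containing u v a b 4≤k (subst (_≤ n G) ∣W₀∣≡k (∣p∣≤n W₀))
  = noSmallerResolving (W - u) (subst (∣ W - u ∣ <_) ∣W∣≡k (x∈p⇒∣p-x∣<∣p∣ u∈W))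
      (resolving-minus-degree-two G connected u~v u~a onlyVA onlyUB b≢u v∈W a∈W b∈W
        (everyResolving W ∣W∣≡k))
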